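{- Let $G$ be a sudoku solution grid and $B\subseteq G$ a minimal unavoidable set. Then there is a sequence $\tau$ of equivalence transformations such that the minimal unavoidable set $\tau(B)$ of the grid $\tau(G)$ contains the same digit in two different cells lying in the same band.
   Context: A sudoku solution grid is regarded as a function $\{0,\dots,80\}\to\{1,\dots,9\}$ (cells numbered left-to-right, top-to-bottom) satisfying the sudoku rules (each row, column and $3\times3$ box contains each digit exactly once), identified with its graph, a subset of $\{0,\dots,80\}\times\{1,\dots,9\}$. A completion of $X\subseteq G$ is a solution grid containing $X$. A subset $X\subseteq G$ is unavoidable if $G\setminus X$ has more than one completion, and minimal if no proper subset is unavoidable. A band is one of the row sets $\{1,2,3\},\{4,5,6\},\{7,8,9\}$; a stack is one of the column sets $\{1,2,3\},\{4,5,6\},\{7,8,9\}$. Equivalence transformations are: relabelling the digits by a permutation in $S_9$; swapping bands (stacks) or swapping rows (columns) within a band (stack); transposing the grid. They act on grids and, cellwise, on subsets of grids (a transformation maps a minimal unavoidable set of $G$ to a minimal unavoidable set of the transformed grid). A blueprint is a representative of an equivalence class of minimal unavoidable sets under these transformations; the paper's statement reads "every blueprint is equivalent to one containing the same digit twice in the same band". -}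

module Defs where

open import Data.Nat using (ℕ)
open import Data.Fin using (Fin; _≟_)
open import Data.Fin.Permutation using (Permutation′; transpose; _⟨$⟩ʳ_)
open import Data.Bool using (Bool; true; false)
open import Data.Product using (Σ; ∃; _×_; _,_; proj₁; proj₂)
open import Data.List using (List; []; _∷_)
open import Relation.Binary.PropositionalEquality using (_≡_; _≢_)
open import Relation.Nullary using (¬_; yes; no)

-- Digits 1..9 are represented by Fin 9.
Digit : Set
Digit = Fin 9

-- A row (resp. column) index 1..9 is represented as (band , row-in-band)
-- (resp. (stack , column-in-stack)) in Fin 3 × Fin 3, i.e. row 3b+i ↔ (b , i).
Idx : Set
Idx = Fin 3 × Fin 3

Cell : Set
Cell = Idx × Idx

Grid : Set
Grid = Idx → Idx → Digit

EachDigitOnce : {I : Set} → (I → Digit) → Set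
EachDigitOnce {I} f = (d : Digit) → Σ I (λ i → f i ≡ d × ((j : I) → f j ≡ d → j ≡ i))

IsSolution : Grid → Set
IsSolution G =
  ((r : Idx) → EachDigitOnce (λ c → G r c)) ×
  ((c : Idx) → EachDigitOnce (λ r → G r c)) ×
  ((b s : Fin 3) → EachDigitOnce (λ (ij : Fin 3 × Fin 3) → G (b , proj₁ ij) (s , proj₂ ij)))

-- A subset X ⊆ G (of the graph of G) is determined by its set of cells;
-- we represent it by its characteristic function on cells.
CellSet : Set
CellSet = Idx → Idx → Bool

IsCompletionOfComplement : Grid → CellSet → Grid → Set
IsCompletionOfComplement G X H =
  IsSolution H × ((r c : Idx) → X r c ≡ false → H r c ≡ G r c)

Unavoidable : Grid → CellSet → Set
Unavoidable G X =
  Σ Grid λ H₁ → Σ Grid λ H₂ →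
    IsCompletionOfComplement G X H₁ × IsCompletionOfComplement G X H₂ ×
    Σ Idx (λ r → Σ Idx (λ c → H₁ r c ≢ H₂ r c))

ProperSubset : CellSet → CellSet → Set
ProperSubset Y X =
  ((r c : Idx) → Y r c ≡ true → X r c ≡ true) ×
  Σ Idx (λ r → Σ Idx (λ c → X r c ≡ true × Y r c ≡ false))

MinimalUnavoidable : Grid → CellSet → Set
MinimalUnavoidable G X =
  Unavoidable G X × ((Y : CellSet) → ProperSubset Y X → ¬ Unavoidable G Y)

data Step : Set where
  relabel    : Permutation′ 9 → Step
  swapBands  : Fin 3 → Fin 3 → Step
  swapRows   : Fin 3 → Fin 3 → Fin 3 → Step
  swapStacks : Fin 3 → Fin 3 → Step
  swapCols   : Fin 3 → Fin 3 → Fin 3 → Step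
  transp     : Step

Marked : Set
Marked = Grid × CellSet

swap3 : Fin 3 → Fin 3 → Fin 3 → Fin 3
swap3 i j x = transpose i j ⟨$⟩ʳ x

swapOuter : Fin 3 → Fin 3 → Idx → Idx
swapOuter i j (b , k) = (swap3 i j b , k)

swapInner : Fin 3 → Fin 3 → Fin 3 → Idx → Idx
swapInner b i j (b' , k) with b' ≟ b
... | yes _ = (b' , swap3 i j k)
... | no  _ = (b' , k)

-- All index maps used are
-- involutions, so cell (r , c) of the new grid receives the old content of the
-- image cell; the subset is transformed cellwise together with the grid.
applyStep : Step → Marked → Marked
applyStep (relabel σ)        (G , X) = (λ r c → σ ⟨$⟩ʳ G r c) , X
applyStep (swapBands i j)    (G , X) = (λ r c → G (swapOuter i j r) c) , (λ r c → X (swapOuter i j r) c)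
applyStep (swapRows b i j)   (G , X) = (λ r c → G (swapInner b i j r) c) , (λ r c → X (swapInner b i j r) c)
applyStep (swapStacks i j)   (G , X) = (λ r c → G r (swapOuter i j c)) , (λ r c → X r (swapOuter i j c))
applyStep (swapCols s i j)   (G , X) = (λ r c → G r (swapInner s i j c)) , (λ r c → X r (swapInner s i j c))
applyStep transp             (G , X) = (λ r c → G c r) , (λ r c → X c r)

applySeq : List Step → Marked → Marked
applySeq []       m = m
applySeq (t ∷ ts) m = applySeq ts (applyStep t m)

SameDigitTwiceInBand : Marked → Set
SameDigitTwiceInBand (G , X) =
  Σ Cell λ p → Σ Cell λ q →
    p ≢ q × X (proj₁ p) (proj₂ p) ≡ true × X (proj₁ q) (proj₂ q) ≡ true ×
    G (proj₁ p) (proj₂ p) ≡ G (proj₁ q) (proj₂ q) ×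
    proj₁ (proj₁ p) ≡ proj₁ (proj₁ q)

module Submission where

-- Take two different completions of G ∖ B; one of them, H, differs from G at
-- some cell p, and every cell where H differs from G lies in B.  Let d be the
-- digit of G at p and let q' be the cell of p's row where H has d.  Then G does
-- not have d at q', and:
--   * if q' lies in another stack, the cell q of q''s box where G has d is a
--     second cell of B with digit d, in the band of p;
--   * if q' lies in the stack of p, the cell q of q''s column where G has d is
--     a second cell of B with digit d, in the stack of p, and transposing the
--     grid moves p and q into a common band.
-- Both cases rest on one fact about a single unit (row, column or box),
-- `displaced`: if H has d at a cell where G does not, then H also differs
-- from G where G has d.

open import Defs
open import Data.Product using (Σ; _,_; proj₁; proj₂; _×_)
open import Data.Sum using (_⊎_; inj₁; inj₂)
open import Data.List using (List; []; _∷_)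
open import Data.Fin using (Fin; _≟_)
open import Data.Bool using (true; false)
open import Relation.Binary.PropositionalEquality
open import Relation.Nullary using (yes; no)
open import Data.Empty using (⊥-elim)

at : {A : Set} → (Idx → Idx → A) → Cell → A
at G p = G (proj₁ p) (proj₂ p)

band : Cell → Fin 3
band p = proj₁ (proj₁ p)

stack : Cell → Fin 3
stack p = proj₁ (proj₂ p)

once-injective : {I : Set} {f : I → Digit} → EachDigitOnce f →
  {i j : I} → f i ≡ f j → i ≡ j
once-injective {f = f} once {i} {j} fi≡fj with once (f i)
... | _ , _ , unique = trans (unique i refl) (sym (unique j (sym fi≡fj)))

displaced : {I : Set} {f g : I → Digit} → EachDigitOnce g →
  {i j : I} {d : Digit} → f i ≡ d → g j ≡ d → f j ≢ d → g i ≢ f i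
displaced {f = f} gOnce {i} {j} {d} fi≡d gj≡d fj≢d gi≡fi =
  fj≢d (subst (λ k → f k ≡ d) i≡j fi≡d)
  where
  i≡j : i ≡ j
  i≡j = once-injective gOnce (trans gi≡fi (trans fi≡d (sym gj≡d)))

Partner : Grid → Grid → Cell → Set
Partner G H p = Σ Cell λ q →
  q ≢ p × at G q ≡ at G p × at H q ≢ at G q × (band q ≡ band p ⊎ stack q ≡ stack p)

partner : (G H : Grid) → IsSolution G → IsSolution H →
  (p : Cell) → at H p ≢ at G p → Partner G H p
partner G H (rowG , colG , boxG) (rowH , colH , boxH) ((b , i) , c) H≢G
  with rowH (b , i) (G (b , i) c)
... | (s' , j') , Hd , _ with s' ≟ proj₁ c
...   | no s'≢s with boxG b s' (G (b , i) c)
...     | (i₂ , j₂) , Gd , _ =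
  ((b , i₂) , (s' , j₂)) , (λ e → s'≢s (cong stack e)) , Gd ,
  displaced (boxH b s') Gd Hd G≢d , inj₁ refl
  where
  -- the digit d = G p occurs in p's row of G only at p
  G≢d : G (b , i) (s' , j') ≢ G (b , i) c
  G≢d e = s'≢s (cong proj₁ (once-injective (rowG (b , i)) e))
partner G H (rowG , colG , boxG) (rowH , colH , boxH) ((b , i) , c) H≢G
  | (s' , j') , Hd , _ | yes s'≡s with colG (s' , j') (G (b , i) c)
...     | r , Gd , _ =
  (r , (s' , j')) , (λ e → c'≢c (cong proj₂ e)) , Gd ,
  displaced (colH (s' , j')) Gd Hd G≢d , inj₂ s'≡s
  where
  -- H has d at (s' , j') in p's row, but not at p
  c'≢c : (s' , j') ≢ c
  c'≢c e = H≢G (subst (λ k → H (b , i) k ≡ G (b , i) c) e Hd)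
  G≢d : G (b , i) (s' , j') ≢ G (b , i) c
  G≢d e = c'≢c (once-injective (rowG (b , i)) e)

differs⇒member : (G H : Grid) (B : CellSet) →
  ((r c : Idx) → B r c ≡ false → H r c ≡ G r c) →
  (p : Cell) → at H p ≢ at G p → at B p ≡ true
differs⇒member G H B agree (r , c) H≢G with B r c in eq
... | true  = refl
... | false = ⊥-elim (H≢G (agree r c eq))

-- If some completion of G ∖ B differs from G, the theorem holds: the differing
-- cell and its partner lie in B, and are in one band possibly after transposing.
fromDifferentCompletion : (G H : Grid) (B : CellSet) → IsSolution G →
  IsCompletionOfComplement G B H → (p : Cell) → at H p ≢ at G p →
  Σ (List Step) (λ τ → SameDigitTwiceInBand (applySeq τ (G , B)))
fromDifferentCompletion G H B solG (solH , agree) p H≢G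
  with partner G H solG solH p H≢G
... | q , q≢p , Gq≡Gp , Hq≢Gq , inj₁ sameBand =
  [] , p , q , (λ e → q≢p (sym e)) ,
  differs⇒member G H B agree p H≢G , differs⇒member G H B agree q Hq≢Gq ,
  sym Gq≡Gp , sym sameBand
... | q , q≢p , Gq≡Gp , Hq≢Gq , inj₂ sameStack =
  transp ∷ [] , flip p , flip q , (λ e → q≢p (sym (flip-injective e))) ,
  differs⇒member G H B agree p H≢G , differs⇒member G H B agree q Hq≢Gq ,
  sym Gq≡Gp , sym sameStack
  where
  flip : Cell → Cell
  flip (r , c) = c , r
  flip-injective : {x y : Cell} → flip x ≡ flip y → x ≡ y
  flip-injective refl = refl

-- Of two different completions of G ∖ B, at the cell where they differ at least
-- one differs from G.
mainTheorem6 : (G : Grid) (B : CellSet) → IsSolution G → MinimalUnavoidable G B →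
    Σ (List Step) (λ τ → SameDigitTwiceInBand (applySeq τ (G , B)))
mainTheorem6 G B solG ((H₁ , H₂ , completion₁ , completion₂ , r , c , H₁≢H₂) , _)
  with H₁ r c ≟ G r c
... | no  H₁≢G = fromDifferentCompletion G H₁ B solG completion₁ (r , c) H₁≢G
... | yes H₁≡G = fromDifferentCompletion G H₂ B solG completion₂ (r , c)
                   (λ H₂≡G → H₁≢H₂ (trans H₁≡G (sym H₂≡G)))
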